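{- Let $\Sigma=(s_i)_{i\in I}$ be a 1-signature. The category $\mathrm{Rep}^{\Delta}(\Sigma)$ of representations of $\Sigma$ in relative monads on $\Delta$ has an initial object. Its underlying relative monad sends each set $X$ to the set $T_\Sigma(X)$ of $\Sigma$-terms with free variables in $X$, equipped with the equality (discrete) preorder.
   Context: $\mathbf{Pre}$ is the category of preordered sets and monotone maps, $\Delta:\mathbf{Set}\to\mathbf{Pre}$ sends $X$ to $(X,=)$; monotone maps $\Delta X\to A$ are the maps $X\to UA$ with $U$ the forgetful functor. A relative monad on $\Delta$ is $(R,\eta,\sigma)$: preordered sets $RX$, maps $\eta_X:X\to RX$, and for each map $f:X\to RY$ a monotone $\sigma(f):RX\to RY$ with $\sigma(f)\circ\eta_X=f$, $\sigma(\eta_X)=\mathrm{id}$, $\sigma(g)\circ\sigma(f)=\sigma(\sigma(g)\circ f)$; morphisms $\tau:R\to Q$ are families of monotone $\tau_X:RX\to QX$ with $\tau_Y\circ\sigma^R(f)=\sigma^Q(\tau_Y\circ f)\circ\tau_X$ and $\tau_X\circ\eta^R_X=\eta^Q_X$. Write $R(h):=\sigma(\eta_Y\circ h)$. A module $M$ over $R$ with codomain $\mathbf{Pre}$ assigns to each set $X$ a preordered set $MX$ and to each map $f:X\to RY$ a monotone $\varsigma(f):MX\to MY$ with $\varsigma(\eta_X)=\mathrm{id}$, $\varsigma(g)\circ\varsigma(f)=\varsigma(\sigma(g)\circ f)$; module morphisms $\rho:M\to N$ are families of monotone maps with $\rho_Y\circ\varsigma^M(f)=\varsigma^N(f)\circ\rho_X$.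 The tautological module is $R$ with $\varsigma=\sigma$; the derived module $M'$ has $M'(X)=M(X+\{*\})$, $\varsigma^{M'}(f)=\varsigma^M(f^{\uparrow})$ with $f^{\uparrow}(\mathrm{inl}\,x)=R(\mathrm{inl})(f(x))$, $f^{\uparrow}(*)=\eta(\mathrm{inr}\,*)$; $(\rho')_X=\rho_{X+\{*\}}$; products of modules are pointwise, the terminal module is constantly a singleton. For a list $s=[n_1,\dots,n_m]$, $M^s:=M^{(n_1)}\times\dots\times M^{(n_m)}$ ($n$-fold derivatives; empty list gives the terminal module), and $\rho^s$ is componentwise. A 1-signature is a family $\Sigma=(s_i)_{i\in I}$ of finite lists of natural numbers. A representation of $\Sigma$ is a relative monad $R$ on $\Delta$ with $R$-module morphisms $s_i^R:R^{s_i}\to R$; a morphism of representations is a morphism $\tau$ of relative monads with $\tau_X\circ(s_i^R)_X=(s_i^Q)_X\circ(\tau^{s_i})_X$ for all $i,X$; this gives the category $\mathrm{Rep}^{\Delta}(\Sigma)$. The sets $T_\Sigma(X)$ are defined inductively (for all sets $X$ simultaneously): every $x\in X$ gives a term $\mathrm{var}(x)\in T_\Sigma(X)$, and for $i\in I$ with $s_i=[n_1,\dots,n_m]$ and terms $t_k\in T_\Sigma(X+\{1,\dots,n_k\})$ ($k=1,\dots,m$) there is a term $i(t_1,\dots,t_m)\in T_\Sigma(X)$. -}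

module Defs where

open import Data.Nat using (ℕ; zero; suc)
open import Data.Fin using (Fin)
open import Data.List using (List; []; _∷_)
open import Data.Sum using (_⊎_; inj₁; inj₂)
open import Data.Unit using (⊤; tt)
open import Data.Product using (Σ; _×_; _,_; proj₁; proj₂)
open import Relation.Binary.PropositionalEquality using (_≡_; refl; trans)

record Pre : Set₁ where
  field
    Carrier : Set
    _≤_     : Carrier → Carrier → Set
    ≤-refl  : ∀ {x} → x ≤ x
    ≤-trans : ∀ {x y z} → x ≤ y → y ≤ z → x ≤ z

∣_∣ : Pre → Set
∣ A ∣ = Pre.Carrier A

record Mono (A B : Pre) : Set where
  field
    fun  : ∣ A ∣ → ∣ B ∣
    mono : ∀ {x y} → Pre._≤_ A x y → Pre._≤_ B (fun x) (fun y)

infixr 5 _·_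
_·_ : ∀ {A B} → Mono A B → ∣ A ∣ → ∣ B ∣
f · x = Mono.fun f x

Δ : Set → Pre
Δ X = record { Carrier = X ; _≤_ = _≡_ ; ≤-refl = refl ; ≤-trans = trans }

_×P_ : Pre → Pre → Pre
A ×P B = record
  { Carrier = ∣ A ∣ × ∣ B ∣
  ; _≤_ = λ p q → Pre._≤_ A (proj₁ p) (proj₁ q) × Pre._≤_ B (proj₂ p) (proj₂ q)
  ; ≤-refl = Pre.≤-refl A , Pre.≤-refl B
  ; ≤-trans = λ p q → Pre.≤-trans A (proj₁ p) (proj₁ q) , Pre.≤-trans B (proj₂ p) (proj₂ q)
  }

⊤P : Pre
⊤P = record { Carrier = ⊤ ; _≤_ = λ _ _ → ⊤ ; ≤-refl = tt ; ≤-trans = λ _ _ → tt }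

-- Relative monads on Δ (equality of maps = pointwise equality)

record RelMonad : Set₁ where
  field
    R     : Set → Pre
    η     : ∀ {X} → X → ∣ R X ∣
    σ     : ∀ {X Y} → (X → ∣ R Y ∣) → Mono (R X) (R Y)
    σ-cong : ∀ {X Y} {f g : X → ∣ R Y ∣} → (∀ x → f x ≡ g x) →
             ∀ r → σ f · r ≡ σ g · r
    σ-η   : ∀ {X Y} (f : X → ∣ R Y ∣) (x : X) → σ f · η x ≡ f x
    σ-id  : ∀ {X} (r : ∣ R X ∣) → σ (η {X}) · r ≡ r
    σ-σ   : ∀ {X Y Z} (f : X → ∣ R Y ∣) (g : Y → ∣ R Z ∣) (r : ∣ R X ∣) →
            σ g · (σ f · r) ≡ σ (λ x → σ g · f x) · r

  Rmap : ∀ {X Y} → (X → Y) → Mono (R X) (R Y)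
  Rmap h = σ (λ x → η (h x))

record RelMonadMor (R Q : RelMonad) : Set₁ where
  private
    module R = RelMonad R
    module Q = RelMonad Q
  field
    τ     : ∀ X → Mono (R.R X) (Q.R X)
    τ-σ   : ∀ {X Y} (f : X → ∣ R.R Y ∣) (r : ∣ R.R X ∣) →
            τ Y · (R.σ f · r) ≡ Q.σ (λ x → τ Y · f x) · (τ X · r)
    τ-η   : ∀ {X} (x : X) → τ X · R.η x ≡ Q.η x

-- Modules over a relative monad (the data used for module morphisms)

record Module (R : RelMonad) : Set₁ where
  private module R = RelMonad R
  field
    obj : Set → Pre
    ς   : ∀ {X Y} → (X → ∣ R.R Y ∣) → Mono (obj X) (obj Y)

record ModuleMor {R : RelMonad} (M N : Module R) : Set₁ where
  private
    module M = Module M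
    module N = Module N
  field
    ρ    : ∀ X → Mono (M.obj X) (N.obj X)
    ρ-ς  : ∀ {X Y} (f : X → ∣ RelMonad.R R Y ∣) (m : ∣ M.obj X ∣) →
           ρ Y · (M.ς f · m) ≡ N.ς f · (ρ X · m)

module _ (𝕄 : RelMonad) where
  open RelMonad 𝕄

  taut : Module 𝕄
  taut = record { obj = RelMonad.R 𝕄 ; ς = σ }

  lift : ∀ {X Y : Set} → (X → ∣ RelMonad.R 𝕄 Y ∣) → (X ⊎ ⊤) → ∣ RelMonad.R 𝕄 (Y ⊎ ⊤) ∣
  lift f (inj₁ x) = Rmap inj₁ · f x
  lift {Y = Y} f (inj₂ t) = η {Y ⊎ ⊤} (inj₂ t)

  derived : Module 𝕄 → Module 𝕄
  derived M = record
    { obj = λ X → Module.obj M (X ⊎ ⊤)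
    ; ς   = λ f → Module.ς M (lift f) }

  deriv : ℕ → Module 𝕄 → Module 𝕄
  deriv zero    M = M
  deriv (suc n) M = derived (deriv n M)

  _×M_ : Module 𝕄 → Module 𝕄 → Module 𝕄
  M ×M N = record
    { obj = λ X → Module.obj M X ×P Module.obj N X
    ; ς   = λ f → record
        { fun  = λ p → Module.ς M f · proj₁ p , Module.ς N f · proj₂ p
        ; mono = λ le → Mono.mono (Module.ς M f) (proj₁ le) , Mono.mono (Module.ς N f) (proj₂ le) } }

  ⊤M : Module 𝕄
  ⊤M = record { obj = λ _ → ⊤P ; ς = λ _ → record { fun = λ _ → tt ; mono = λ _ → tt } }

  Pow : Module 𝕄 → List ℕ → Module 𝕄
  Pow M []           = ⊤M
  Pow M (n ∷ [])     = deriv n M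
  Pow M (n ∷ m ∷ s)  = deriv n M ×M Pow M (m ∷ s)

derivMap : {R Q : RelMonad} (τ : ∀ X → ∣ RelMonad.R R X ∣ → ∣ RelMonad.R Q X ∣) →
           ∀ n X → ∣ Module.obj (deriv R n (taut R)) X ∣ → ∣ Module.obj (deriv Q n (taut Q)) X ∣
derivMap τ zero    X r = τ X r
derivMap τ (suc n) X r = derivMap τ n (X ⊎ ⊤) r

powMap : {R Q : RelMonad} (τ : ∀ X → ∣ RelMonad.R R X ∣ → ∣ RelMonad.R Q X ∣) →
         ∀ s X → ∣ Module.obj (Pow R (taut R) s) X ∣ → ∣ Module.obj (Pow Q (taut Q) s) X ∣
powMap τ []          X _       = tt
powMap τ (n ∷ [])    X r       = derivMap τ n X r
powMap τ (n ∷ m ∷ s) X (r , a) = derivMap τ n X r , powMap τ (m ∷ s) X a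

record Sig : Set₁ where
  field
    Idx : Set
    ar  : Idx → List ℕ

record Rep (S : Sig) : Set₁ where
  field
    mon : RelMonad
    op  : (i : Sig.Idx S) → ModuleMor (Pow mon (taut mon) (Sig.ar S i)) (taut mon)

record RepMor {S : Sig} (R Q : Rep S) : Set₁ where
  private
    module R = Rep R
    module Q = Rep Q
  field
    mor  : RelMonadMor R.mon Q.mon
  τ : ∀ X → ∣ RelMonad.R R.mon X ∣ → ∣ RelMonad.R Q.mon X ∣
  τ X r = RelMonadMor.τ mor X · r
  field
    mor-op : ∀ (i : Sig.Idx S) X (a : ∣ Module.obj (Pow R.mon (taut R.mon) (Sig.ar S i)) X ∣) →
             τ X (ModuleMor.ρ (R.op i) X · a)
               ≡ ModuleMor.ρ (Q.op i) X · powMap τ (Sig.ar S i) X a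

-- initial object of Rep^Δ(S); morphisms are equal when all components agree pointwise
IsInitial : {S : Sig} → Rep S → Set₁
IsInitial {S} R = ∀ (Q : Rep S) →
  Σ (RepMor R Q) λ m → ∀ (m' : RepMor R Q) → ∀ X r → RepMor.τ m X r ≡ RepMor.τ m' X r

-- Σ-terms.  Tm S X Γ represents T_Σ(Ctx X Γ), where
-- Ctx X [] = X, Ctx X (n ∷ Γ) = Ctx X Γ + {1,…,n}.

Ctx : Set → List ℕ → Set
Ctx X []      = X
Ctx X (n ∷ Γ) = Ctx X Γ ⊎ Fin n

module _ (S : Sig) (X : Set) where
  open Sig S
  data Tm   : List ℕ → Set
  data Args : List ℕ → List ℕ → Set

  data Tm where
    var : ∀ {Γ} → Ctx X Γ → Tm Γ
    op  : ∀ {Γ} (i : Idx) → Args (ar i) Γ → Tm Γ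

  data Args where
    []  : ∀ {Γ} → Args [] Γ
    _∷_ : ∀ {n ns Γ} → Tm (n ∷ Γ) → Args ns Γ → Args (n ∷ ns) Γ

T : Sig → Set → Set
T S X = Tm S X []

module Submission where

-- The initial representation of a 1-signature S is its syntax: X ↦ T_S(X) with
-- the discrete preorder, variables as unit, capture-avoiding substitution as
-- Kleisli extension, and the term constructors as the module morphisms.  For
-- another representation Q the unique morphism is the fold ⟦_⟧ interpreting each
-- constructor by the corresponding operation of Q: it commutes with substitution
-- because the operations of Q are module morphisms, and any morphism agrees with
-- it because it satisfies the same recursive equations.
--
-- Terms 'Tm S X Γ' have variables Ctx X Γ, and a binder of arity n adds Fin n to
-- the scope, whereas the n-th derivative of a module lives over 'Adj n X' (X with n
-- variables adjoined one at a time); the two are related by a bijection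
-- Adj n X ≅ X ⊎ Fin n.

open import Defs
open import Data.Fin using (Fin; zero; suc)
open import Data.List using (List; []; _∷_)
open import Data.Nat using (ℕ; zero; suc)
open import Data.Product using (Σ; _×_; _,_)
open import Data.Sum using (_⊎_; inj₁; inj₂)
open import Data.Unit using (⊤; tt)
open import Relation.Binary.PropositionalEquality
  using (_≡_; refl; sym; trans; cong; cong₂; subst; module ≡-Reasoning)

private variable
  X Y Z : Set
  Γ Φ Ψ ns : List ℕ
  n : ℕ

-- Adj n X is the scope of the n-th derivative of a module at X.
Adj : ℕ → Set → Set
Adj zero    X = X
Adj (suc n) X = Adj n (X ⊎ ⊤)

-- The k-th fresh variable of X ⊎ Fin n is the k-th adjoined one.
toAdj : ∀ n → X ⊎ Fin n → Adj n X
toAdj zero    (inj₁ x)       = x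
toAdj zero    (inj₂ ())
toAdj (suc n) (inj₁ x)       = toAdj n (inj₁ (inj₁ x))
toAdj (suc n) (inj₂ zero)    = toAdj n (inj₁ (inj₂ tt))
toAdj (suc n) (inj₂ (suc k)) = toAdj n (inj₂ k)

absorb : (X ⊎ ⊤) ⊎ Fin n → X ⊎ Fin (suc n)
absorb (inj₁ (inj₁ x))  = inj₁ x
absorb (inj₁ (inj₂ tt)) = inj₂ zero
absorb (inj₂ k)         = inj₂ (suc k)

fromAdj : ∀ n → Adj n X → X ⊎ Fin n
fromAdj zero    x = inj₁ x
fromAdj (suc n) w = absorb (fromAdj n w)

fromAdj-toAdj : ∀ n (v : X ⊎ Fin n) → fromAdj n (toAdj n v) ≡ v
fromAdj-toAdj zero    (inj₁ x)       = refl
fromAdj-toAdj zero    (inj₂ ())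
fromAdj-toAdj (suc n) (inj₁ x)       = cong absorb (fromAdj-toAdj n (inj₁ (inj₁ x)))
fromAdj-toAdj (suc n) (inj₂ zero)    = cong absorb (fromAdj-toAdj n (inj₁ (inj₂ tt)))
fromAdj-toAdj (suc n) (inj₂ (suc k)) = cong absorb (fromAdj-toAdj n (inj₂ k))

toAdj-fromAdj : ∀ n (w : Adj n X) → toAdj n (fromAdj n w) ≡ w
toAdj-fromAdj zero    w = refl
toAdj-fromAdj (suc n) w = trans (toAdj-absorb (fromAdj n w)) (toAdj-fromAdj n w)
  where
  toAdj-absorb : ∀ v → toAdj (suc n) (absorb v) ≡ toAdj n v
  toAdj-absorb (inj₁ (inj₁ x))  = refl
  toAdj-absorb (inj₁ (inj₂ tt)) = refl
  toAdj-absorb (inj₂ k)         = refl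

module RelMonadFacts (𝕄 : RelMonad) where
  open RelMonad 𝕄

  σ-Rmap : (f : Y → ∣ R Z ∣) (k : X → Y) (r : ∣ R X ∣) →
           σ f · (Rmap k · r) ≡ σ (λ x → f (k x)) · r
  σ-Rmap f k r = trans (σ-σ _ f r) (σ-cong (λ x → σ-η f (k x)) r)

  lift^ : ∀ n → (X → ∣ R Y ∣) → Adj n X → ∣ R (Adj n Y) ∣
  lift^ zero    f = f
  lift^ (suc n) f = lift^ n (lift 𝕄 f)

  lift^-old : ∀ n (f : X → ∣ R Y ∣) x →
              lift^ n f (toAdj n (inj₁ x)) ≡ Rmap (λ y → toAdj n (inj₁ y)) · f x
  lift^-old zero    f x = sym (σ-id (f x))
  lift^-old (suc n) f x = trans (lift^-old n (lift 𝕄 f) (inj₁ x)) (σ-Rmap _ inj₁ (f x))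

  lift^-fresh : ∀ n (f : X → ∣ R Y ∣) k → lift^ n f (toAdj n (inj₂ k)) ≡ η (toAdj n (inj₂ k))
  lift^-fresh zero    f ()
  lift^-fresh (suc n) f zero    = trans (lift^-old n (lift 𝕄 f) (inj₂ tt)) (σ-η _ (inj₂ tt))
  lift^-fresh (suc n) f (suc k) = lift^-fresh n (lift 𝕄 f) k

  Extends : ∀ n → (X → ∣ R Y ∣) → (X ⊎ Fin n → ∣ R (Y ⊎ Fin n) ∣) → Set
  Extends n g h = (∀ x → h (inj₁ x) ≡ Rmap inj₁ · g x) × (∀ k → h (inj₂ k) ≡ η (inj₂ k))

  lift^-toAdj : ∀ n (g : X → ∣ R Y ∣) h → Extends n g h → ∀ q →
                σ (lift^ n g) · (Rmap (toAdj n) · q) ≡ Rmap (toAdj n) · (σ h · q)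
  lift^-toAdj n g h (h-old , h-fresh) q =
    trans (σ-Rmap (lift^ n g) (toAdj n) q) (trans (σ-cong agree q) (sym (σ-σ h _ q)))
    where
    agree : ∀ v → lift^ n g (toAdj n v) ≡ Rmap (toAdj n) · h v
    agree (inj₁ x) = trans (lift^-old n g x)
      (sym (trans (cong (Rmap (toAdj n) ·_) (h-old x)) (σ-Rmap _ inj₁ (g x))))
    agree (inj₂ k) = trans (lift^-fresh n g k)
      (sym (trans (cong (Rmap (toAdj n) ·_) (h-fresh k)) (σ-η _ (inj₂ k))))

  Der : ℕ → Set → Pre
  Der n = Module.obj (deriv 𝕄 n (taut 𝕄))

  DObj : ℕ → Set → Set
  DObj n X = ∣ Der n X ∣

  ςᴰ : ∀ n → (X → ∣ R Y ∣) → Mono (Der n X) (Der n Y)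
  ςᴰ n = Module.ς (deriv 𝕄 n (taut 𝕄))

  Powᴾ : List ℕ → Set → Pre
  Powᴾ s = Module.obj (Pow 𝕄 (taut 𝕄) s)

  PObj : List ℕ → Set → Set
  PObj s X = ∣ Powᴾ s X ∣

  ςᴾ : ∀ s → (X → ∣ R Y ∣) → Mono (Powᴾ s X) (Powᴾ s Y)
  ςᴾ s = Module.ς (Pow 𝕄 (taut 𝕄) s)

  -- R^(n ∷ s) is R^(n) × R^s, except that R^[n] is R^(n) alone.
  consᴾ : ∀ {n} ns → DObj n X → PObj ns X → PObj (n ∷ ns) X
  consᴾ []      d _ = d
  consᴾ (_ ∷ _) d p = d , p

  -- DObj n X is R (Adj n X), although only by induction on n.
  inD : ∀ n → ∣ R (Adj n X) ∣ → DObj n X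
  inD zero    r = r
  inD (suc n) r = inD n r

  outD : ∀ n → DObj n X → ∣ R (Adj n X) ∣
  outD zero    u = u
  outD (suc n) u = outD n u

  outD-inD : ∀ n (r : ∣ R (Adj n X) ∣) → outD n (inD n r) ≡ r
  outD-inD zero    r = refl
  outD-inD (suc n) r = outD-inD n r

  inD-outD : ∀ n (u : DObj n X) → inD n (outD n u) ≡ u
  inD-outD zero    u = refl
  inD-outD (suc n) u = inD-outD n u

  ς-inD : ∀ n (f : X → ∣ R Y ∣) r → ςᴰ n f · inD n r ≡ inD n (σ (lift^ n f) · r)
  ς-inD zero    f r = refl
  ς-inD (suc n) f r = ς-inD n (lift 𝕄 f) r

  outD-ς : ∀ n (f : X → ∣ R Y ∣) u → outD n (ςᴰ n f · u) ≡ σ (lift^ n f) · outD n u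
  outD-ς zero    f u = refl
  outD-ς (suc n) f u = outD-ς n (lift 𝕄 f) u

  pack : ∀ n → ∣ R (X ⊎ Fin n) ∣ → DObj n X
  pack n q = inD n (Rmap (toAdj n) · q)

  ς-pack : ∀ n (g : X → ∣ R Y ∣) h → Extends n g h → ∀ q → ςᴰ n g · pack n q ≡ pack n (σ h · q)
  ς-pack n g h ext q = trans (ς-inD n g _) (cong (inD n) (lift^-toAdj n g h ext q))

  pack-fromAdj : ∀ n (r : ∣ R (Adj n X) ∣) → pack n (Rmap (fromAdj n) · r) ≡ inD n r
  pack-fromAdj n r = cong (inD n) (begin
      Rmap (toAdj n) · (Rmap (fromAdj n) · r)  ≡⟨ σ-Rmap _ (fromAdj n) r ⟩
      σ (λ w → η (toAdj n (fromAdj n w))) · r  ≡⟨ σ-cong (λ w → cong η (toAdj-fromAdj n w)) r ⟩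
      σ η · r                                  ≡⟨ σ-id r ⟩
      r                                        ∎)
    where open ≡-Reasoning

module _ {R Q : RelMonad} (τ : ∀ X → ∣ RelMonad.R R X ∣ → ∣ RelMonad.R Q X ∣) where
  private
    module RF = RelMonadFacts R
    module QF = RelMonadFacts Q

  derivMap-inD : ∀ n X r → derivMap τ n X (RF.inD n r) ≡ QF.inD n (τ (Adj n X) r)
  derivMap-inD zero    X r = refl
  derivMap-inD (suc n) X r = derivMap-inD n (X ⊎ ⊤) r

module Syntax (S : Sig) where

  -- Maps of variables and substitutions from the scope Ctx X Γ to Ctx Y Φ.  They
  -- are records so that the scopes can be inferred (Ctx is not injective).
  record Ren (X : Set) (Γ : List ℕ) (Y : Set) (Φ : List ℕ) : Set where
    constructor ren⟨_⟩
    field _$ʳ_ : Ctx X Γ → Ctx Y Φ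
  open Ren public

  record Sub (X : Set) (Γ : List ℕ) (Y : Set) (Φ : List ℕ) : Set where
    constructor sub⟨_⟩
    field _$ˢ_ : Ctx X Γ → Tm S Y Φ
  open Sub public

  ext : Ren X Γ Y Φ → Ren X (n ∷ Γ) Y (n ∷ Φ)
  ext ρ $ʳ inj₁ x = inj₁ (ρ $ʳ x)
  ext ρ $ʳ inj₂ k = inj₂ k

  ren  : Ren X Γ Y Φ → Tm S X Γ → Tm S Y Φ
  renA : Ren X Γ Y Φ → Args S X ns Γ → Args S Y ns Φ
  ren ρ (var x)   = var (ρ $ʳ x)
  ren ρ (op i as) = op i (renA ρ as)
  renA ρ []       = []
  renA ρ (t ∷ as) = ren (ext ρ) t ∷ renA ρ as

  wk : Ren Y Φ Y (n ∷ Φ)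
  wk = ren⟨ inj₁ ⟩

  exts : Sub X Γ Y Φ → Sub X (n ∷ Γ) Y (n ∷ Φ)
  exts σ $ˢ inj₁ x = ren wk (σ $ˢ x)
  exts σ $ˢ inj₂ k = var (inj₂ k)

  sub  : Sub X Γ Y Φ → Tm S X Γ → Tm S Y Φ
  subA : Sub X Γ Y Φ → Args S X ns Γ → Args S Y ns Φ
  sub σ (var x)   = σ $ˢ x
  sub σ (op i as) = op i (subA σ as)
  subA σ []       = []
  subA σ (t ∷ as) = sub (exts σ) t ∷ subA σ as

  -- Each law below is stated for maps agreeing pointwise with a given composite,
  -- so that it applies to the binder-extended maps in its own inductive step.

  ren-ren : {ρ₁ : Ren X Γ Y Φ} {ρ₂ : Ren Y Φ Z Ψ} {ρ : Ren X Γ Z Ψ} →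
            (∀ x → ρ₂ $ʳ (ρ₁ $ʳ x) ≡ ρ $ʳ x) → ∀ t → ren ρ₂ (ren ρ₁ t) ≡ ren ρ t
  renA-ren : {ρ₁ : Ren X Γ Y Φ} {ρ₂ : Ren Y Φ Z Ψ} {ρ : Ren X Γ Z Ψ} →
             (∀ x → ρ₂ $ʳ (ρ₁ $ʳ x) ≡ ρ $ʳ x) → (as : Args S X ns Γ) →
             renA ρ₂ (renA ρ₁ as) ≡ renA ρ as
  ren-ren e (var x)   = cong var (e x)
  ren-ren e (op i as) = cong (op i) (renA-ren e as)
  renA-ren e []       = refl
  renA-ren e (t ∷ as) =
    cong₂ _∷_ (ren-ren (λ { (inj₁ x) → cong inj₁ (e x) ; (inj₂ k) → refl }) t) (renA-ren e as)

  ren-id : {ρ : Ren X Γ X Γ} → (∀ x → ρ $ʳ x ≡ x) → ∀ t → ren ρ t ≡ t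
  renA-id : {ρ : Ren X Γ X Γ} → (∀ x → ρ $ʳ x ≡ x) →
            (as : Args S X ns Γ) → renA ρ as ≡ as
  ren-id e (var x)   = cong var (e x)
  ren-id e (op i as) = cong (op i) (renA-id e as)
  renA-id e []       = refl
  renA-id e (t ∷ as) =
    cong₂ _∷_ (ren-id (λ { (inj₁ x) → cong inj₁ (e x) ; (inj₂ k) → refl }) t) (renA-id e as)

  sub-cong : {σ τ : Sub X Γ Y Φ} → (∀ x → σ $ˢ x ≡ τ $ˢ x) → ∀ t → sub σ t ≡ sub τ t
  subA-cong : {σ τ : Sub X Γ Y Φ} → (∀ x → σ $ˢ x ≡ τ $ˢ x) →
              (as : Args S X ns Γ) → subA σ as ≡ subA τ as
  sub-cong e (var x)   = e x
  sub-cong e (op i as) = cong (op i) (subA-cong e as)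
  subA-cong e []       = refl
  subA-cong e (t ∷ as) =
    cong₂ _∷_ (sub-cong (λ { (inj₁ x) → cong (ren wk) (e x) ; (inj₂ k) → refl }) t) (subA-cong e as)

  sub-var : {σ : Sub X Γ Y Φ} {ρ : Ren X Γ Y Φ} → (∀ x → σ $ˢ x ≡ var (ρ $ʳ x)) →
            ∀ t → sub σ t ≡ ren ρ t
  subA-var : {σ : Sub X Γ Y Φ} {ρ : Ren X Γ Y Φ} → (∀ x → σ $ˢ x ≡ var (ρ $ʳ x)) →
             (as : Args S X ns Γ) → subA σ as ≡ renA ρ as
  sub-var e (var x)   = e x
  sub-var e (op i as) = cong (op i) (subA-var e as)
  subA-var e []       = refl
  subA-var e (t ∷ as) =
    cong₂ _∷_ (sub-var (λ { (inj₁ x) → cong (ren wk) (e x) ; (inj₂ k) → refl }) t) (subA-var e as)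

  sub-ren : {ρ : Ren X Γ Y Φ} {σ : Sub Y Φ Z Ψ} {τ : Sub X Γ Z Ψ} →
            (∀ x → σ $ˢ (ρ $ʳ x) ≡ τ $ˢ x) → ∀ t → sub σ (ren ρ t) ≡ sub τ t
  subA-ren : {ρ : Ren X Γ Y Φ} {σ : Sub Y Φ Z Ψ} {τ : Sub X Γ Z Ψ} →
             (∀ x → σ $ˢ (ρ $ʳ x) ≡ τ $ˢ x) → (as : Args S X ns Γ) →
             subA σ (renA ρ as) ≡ subA τ as
  sub-ren e (var x)   = e x
  sub-ren e (op i as) = cong (op i) (subA-ren e as)
  subA-ren e []       = refl
  subA-ren e (t ∷ as) =
    cong₂ _∷_ (sub-ren (λ { (inj₁ x) → cong (ren wk) (e x) ; (inj₂ k) → refl }) t) (subA-ren e as)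

  ren-wk : (ρ : Ren Y Φ Z Ψ) (t : Tm S Y Φ) → ren (ext {n = n} ρ) (ren wk t) ≡ ren wk (ren ρ t)
  ren-wk ρ t = trans (ren-ren (λ _ → refl) t) (sym (ren-ren (λ _ → refl) t))

  ren-sub : {σ : Sub X Γ Y Φ} {ρ : Ren Y Φ Z Ψ} {τ : Sub X Γ Z Ψ} →
            (∀ x → ren ρ (σ $ˢ x) ≡ τ $ˢ x) → ∀ t → ren ρ (sub σ t) ≡ sub τ t
  renA-sub : {σ : Sub X Γ Y Φ} {ρ : Ren Y Φ Z Ψ} {τ : Sub X Γ Z Ψ} →
             (∀ x → ren ρ (σ $ˢ x) ≡ τ $ˢ x) → (as : Args S X ns Γ) →
             renA ρ (subA σ as) ≡ subA τ as
  ren-sub e (var x)   = e x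
  ren-sub e (op i as) = cong (op i) (renA-sub e as)
  renA-sub e []       = refl
  renA-sub {σ = σ} {ρ} {τ} e (t ∷ as) = cong₂ _∷_ (ren-sub e′ t) (renA-sub e as)
    where
    e′ : ∀ v → ren (ext ρ) (exts σ $ˢ v) ≡ exts τ $ˢ v
    e′ (inj₁ x) = trans (ren-wk ρ (σ $ˢ x)) (cong (ren wk) (e x))
    e′ (inj₂ k) = refl

  sub-wk : (σ : Sub Y Φ Z Ψ) (t : Tm S Y Φ) → sub (exts {n = n} σ) (ren wk t) ≡ ren wk (sub σ t)
  sub-wk σ t = trans (sub-ren (λ _ → refl) t) (sym (ren-sub (λ _ → refl) t))

  sub-sub : {σ₁ : Sub X Γ Y Φ} {σ₂ : Sub Y Φ Z Ψ} {τ : Sub X Γ Z Ψ} →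
            (∀ x → sub σ₂ (σ₁ $ˢ x) ≡ τ $ˢ x) → ∀ t → sub σ₂ (sub σ₁ t) ≡ sub τ t
  subA-sub : {σ₁ : Sub X Γ Y Φ} {σ₂ : Sub Y Φ Z Ψ} {τ : Sub X Γ Z Ψ} →
             (∀ x → sub σ₂ (σ₁ $ˢ x) ≡ τ $ˢ x) → (as : Args S X ns Γ) →
             subA σ₂ (subA σ₁ as) ≡ subA τ as
  sub-sub e (var x)   = e x
  sub-sub e (op i as) = cong (op i) (subA-sub e as)
  subA-sub e []       = refl
  subA-sub {σ₁ = σ₁} {σ₂} {τ} e (t ∷ as) = cong₂ _∷_ (sub-sub e′ t) (subA-sub e as)
    where
    e′ : ∀ v → sub (exts σ₂) (exts σ₁ $ˢ v) ≡ exts τ $ˢ v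
    e′ (inj₁ x) = trans (sub-wk σ₂ (σ₁ $ˢ x)) (cong (ren wk) (e x))
    e′ (inj₂ k) = refl

  sub-id : (t : Tm S X Γ) → sub sub⟨ var ⟩ t ≡ t
  sub-id t = trans (sub-var {ρ = ren⟨ (λ x → x) ⟩} (λ _ → refl) t) (ren-id (λ _ → refl) t)

module TermRepresentation (S : Sig) where
  open Sig S
  open Syntax S

  closed : (X → T S Y) → Sub X [] Y []
  closed = sub⟨_⟩

  termMonad : RelMonad
  termMonad = record
    { R      = λ X → Δ (T S X)
    ; η      = var
    ; σ      = λ f → record { fun = sub (closed f) ; mono = cong (sub (closed f)) }
    ; σ-cong = sub-cong
    ; σ-η    = λ f x → refl
    ; σ-id   = sub-id
    ; σ-σ    = λ f g → sub-sub (λ _ → refl)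
    }

  open RelMonad termMonad using (Rmap)
  open RelMonadFacts termMonad

  Rmap-ren : (h : X → Y) (t : T S X) → Rmap h · t ≡ ren ren⟨ h ⟩ t
  Rmap-ren h = sub-var (λ _ → refl)

  packTm : ∀ n → Tm S X (n ∷ []) → DObj n X
  packTm n t = inD n (ren ren⟨ toAdj n ⟩ t)

  unpackTm : ∀ n → DObj n X → Tm S X (n ∷ [])
  unpackTm n u = ren ren⟨ fromAdj n ⟩ (outD n u)

  unpack-pack : ∀ n (t : Tm S X (n ∷ [])) → unpackTm n (packTm n t) ≡ t
  unpack-pack n t = begin
    ren ren⟨ fromAdj n ⟩ (outD n (inD n (ren ren⟨ toAdj n ⟩ t)))
      ≡⟨ cong (ren _) (outD-inD n _) ⟩
    ren ren⟨ fromAdj n ⟩ (ren ren⟨ toAdj n ⟩ t)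
      ≡⟨ ren-ren {ρ = ren⟨ (λ v → v) ⟩} (fromAdj-toAdj n) t ⟩
    ren ren⟨ (λ v → v) ⟩ t
      ≡⟨ ren-id (λ _ → refl) t ⟩
    t ∎
    where open ≡-Reasoning

  outD-discrete : ∀ n {u v : DObj n X} → Pre._≤_ (Der n X) u v → outD n u ≡ outD n v
  outD-discrete zero    u≤v = u≤v
  outD-discrete (suc n) u≤v = outD-discrete n u≤v

  ς-unpackTm : ∀ n (f : X → T S Y) (u : DObj n X) →
               sub (exts (closed f)) (unpackTm n u) ≡ unpackTm n (ςᴰ n f · u)
  ς-unpackTm n f u = begin
    sub (exts (closed f)) (ren κ r)
      ≡⟨ sub-ren (λ _ → refl) r ⟩
    sub sub⟨ (λ w → exts (closed f) $ˢ fromAdj n w) ⟩ r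
      ≡⟨ sub-cong agree r ⟩
    sub sub⟨ (λ w → ren κ (lift^ n f w)) ⟩ r
      ≡⟨ sym (ren-sub (λ _ → refl) r) ⟩
    ren κ (sub (closed (lift^ n f)) r)
      ≡⟨ cong (ren κ) (sym (outD-ς n f u)) ⟩
    unpackTm n (ςᴰ n f · u) ∎
    where
    open ≡-Reasoning
    r : T S (Adj n _)
    r = outD n u

    κ : ∀ {Z} → Ren (Adj n Z) [] Z (n ∷ [])
    κ = ren⟨ fromAdj n ⟩

    agreeOn : ∀ v → exts (closed f) $ˢ v ≡ ren κ (lift^ n f (toAdj n v))
    agreeOn (inj₁ x) = sym (begin
      ren κ (lift^ n f (toAdj n (inj₁ x)))               ≡⟨ cong (ren κ) (lift^-old n f x) ⟩
      ren κ (Rmap (λ y → toAdj n (inj₁ y)) · f x)        ≡⟨ cong (ren κ) (Rmap-ren _ (f x)) ⟩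
      ren κ (ren ren⟨ (λ y → toAdj n (inj₁ y)) ⟩ (f x))
        ≡⟨ ren-ren (λ y → fromAdj-toAdj n (inj₁ y)) (f x) ⟩
      ren wk (f x)                                       ∎)
    agreeOn (inj₂ k) = sym (begin
      ren κ (lift^ n f (toAdj n (inj₂ k)))  ≡⟨ cong (ren κ) (lift^-fresh n f k) ⟩
      var (fromAdj n (toAdj n (inj₂ k)))    ≡⟨ cong var (fromAdj-toAdj n (inj₂ k)) ⟩
      var (inj₂ k)                          ∎)

    agree : ∀ w → exts (closed f) $ˢ fromAdj n w ≡ ren κ (lift^ n f w)
    agree w = subst (λ w′ → exts (closed f) $ˢ fromAdj n w ≡ ren κ (lift^ n f w′))
                    (toAdj-fromAdj n w) (agreeOn (fromAdj n w))

  argsOf : ∀ s → PObj s X → Args S X s []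
  argsOf []          _       = []
  argsOf (n ∷ [])    u       = unpackTm n u ∷ []
  argsOf (n ∷ m ∷ s) (u , a) = unpackTm n u ∷ argsOf (m ∷ s) a

  argsTo : ∀ s → Args S X s [] → PObj s X
  argsTo []          []        = tt
  argsTo (n ∷ [])    (t ∷ [])  = packTm n t
  argsTo (n ∷ m ∷ s) (t ∷ as)  = packTm n t , argsTo (m ∷ s) as

  argsOf-argsTo : ∀ s (as : Args S X s []) → argsOf s (argsTo s as) ≡ as
  argsOf-argsTo []          []       = refl
  argsOf-argsTo (n ∷ [])    (t ∷ []) = cong (_∷ []) (unpack-pack n t)
  argsOf-argsTo (n ∷ m ∷ s) (t ∷ as) = cong₂ _∷_ (unpack-pack n t) (argsOf-argsTo (m ∷ s) as)

  argsOf-discrete : ∀ s {a b : PObj s X} → Pre._≤_ (Powᴾ s X) a b →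
                    argsOf s a ≡ argsOf s b
  argsOf-discrete []          _           = refl
  argsOf-discrete (n ∷ [])    u≤v         = cong (λ r → ren _ r ∷ []) (outD-discrete n u≤v)
  argsOf-discrete (n ∷ m ∷ s) (u≤v , a≤b) =
    cong₂ (λ r as → ren _ r ∷ as) (outD-discrete n u≤v) (argsOf-discrete (m ∷ s) a≤b)

  argsOf-ς : ∀ s (f : X → T S Y) (a : PObj s X) →
             subA (closed f) (argsOf s a) ≡ argsOf s (ςᴾ s f · a)
  argsOf-ς []          f _       = refl
  argsOf-ς (n ∷ [])    f u       = cong (_∷ []) (ς-unpackTm n f u)
  argsOf-ς (n ∷ m ∷ s) f (u , a) = cong₂ _∷_ (ς-unpackTm n f u) (argsOf-ς (m ∷ s) f a)

  termOp : (i : Idx) → ModuleMor (Pow termMonad (taut termMonad) (ar i)) (taut termMonad)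
  termOp i = record
    { ρ   = λ X → record { fun = λ a → op i (argsOf (ar i) a)
                         ; mono = λ a≤b → cong (op i) (argsOf-discrete (ar i) a≤b) }
    ; ρ-ς = λ f a → cong (op i) (sym (argsOf-ς (ar i) f a))
    }

  termRep : Rep S
  termRep = record { mon = termMonad ; op = termOp }

module Initiality (S : Sig) (Q : Rep S) where
  open Sig S
  open Syntax S
  open TermRepresentation S
  private
    Qm : RelMonad
    Qm = Rep.mon Q
    module Q = RelMonad Qm
    module QF = RelMonadFacts Qm
    module TF = RelMonadFacts termMonad

  opQ : (i : Idx) → QF.PObj (ar i) X → ∣ Q.R X ∣
  opQ i a = ModuleMor.ρ (Rep.op Q i) _ · a

  opQ-ς : (i : Idx) (f : X → ∣ Q.R Y ∣) (a : QF.PObj (ar i) X) →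
          opQ i (QF.ςᴾ (ar i) f · a) ≡ Q.σ f · opQ i a
  opQ-ς i = ModuleMor.ρ-ς (Rep.op Q i)

  ⟦_⟧  : Tm S X Γ → ∣ Q.R (Ctx X Γ) ∣
  ⟦_⟧ᴬ : Args S X ns Γ → QF.PObj ns (Ctx X Γ)
  ⟦ var x ⟧   = Q.η x
  ⟦ op i as ⟧ = opQ i ⟦ as ⟧ᴬ
  ⟦ [] ⟧ᴬ = tt
  ⟦ _∷_ {ns = ns} t as ⟧ᴬ = QF.consᴾ ns (QF.pack _ ⟦ t ⟧) ⟦ as ⟧ᴬ

  ⟦ren⟧  : (ρ : Ren X Γ Y Φ) (t : Tm S X Γ) → ⟦ ren ρ t ⟧ ≡ Q.Rmap (ρ $ʳ_) · ⟦ t ⟧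
  ⟦ren⟧ᴬ : (ρ : Ren X Γ Y Φ) (as : Args S X ns Γ) →
           ⟦ renA ρ as ⟧ᴬ ≡ QF.ςᴾ ns (λ x → Q.η (ρ $ʳ x)) · ⟦ as ⟧ᴬ
  ⟦ren⟧ᴮ : (ρ : Ren X Γ Y Φ) (t : Tm S X (n ∷ Γ)) →
           QF.pack n ⟦ ren (ext ρ) t ⟧ ≡ QF.ςᴰ n (λ x → Q.η (ρ $ʳ x)) · QF.pack n ⟦ t ⟧
  ⟦ren⟧ ρ (var x)   = sym (Q.σ-η _ x)
  ⟦ren⟧ ρ (op i as) = trans (cong (opQ i) (⟦ren⟧ᴬ ρ as)) (opQ-ς i _ ⟦ as ⟧ᴬ)
  ⟦ren⟧ᴬ ρ []           = refl
  ⟦ren⟧ᴬ ρ (t ∷ [])     = ⟦ren⟧ᴮ ρ t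
  ⟦ren⟧ᴬ ρ (t ∷ u ∷ as) = cong₂ _,_ (⟦ren⟧ᴮ ρ t) (⟦ren⟧ᴬ ρ (u ∷ as))
  ⟦ren⟧ᴮ {n = n} ρ t = trans (cong (QF.pack n) (⟦ren⟧ (ext ρ) t))
    (sym (QF.ς-pack n _ _ ((λ x → sym (Q.σ-η _ (ρ $ʳ x))) , (λ k → refl)) ⟦ t ⟧))

  ⟦sub⟧  : (σ : Sub X Γ Y Φ) (t : Tm S X Γ) → ⟦ sub σ t ⟧ ≡ Q.σ (λ x → ⟦ σ $ˢ x ⟧) · ⟦ t ⟧
  ⟦sub⟧ᴬ : (σ : Sub X Γ Y Φ) (as : Args S X ns Γ) →
           ⟦ subA σ as ⟧ᴬ ≡ QF.ςᴾ ns (λ x → ⟦ σ $ˢ x ⟧) · ⟦ as ⟧ᴬ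
  ⟦sub⟧ᴮ : (σ : Sub X Γ Y Φ) (t : Tm S X (n ∷ Γ)) →
           QF.pack n ⟦ sub (exts σ) t ⟧ ≡ QF.ςᴰ n (λ x → ⟦ σ $ˢ x ⟧) · QF.pack n ⟦ t ⟧
  ⟦sub⟧ σ (var x)   = sym (Q.σ-η _ x)
  ⟦sub⟧ σ (op i as) = trans (cong (opQ i) (⟦sub⟧ᴬ σ as)) (opQ-ς i _ ⟦ as ⟧ᴬ)
  ⟦sub⟧ᴬ σ []           = refl
  ⟦sub⟧ᴬ σ (t ∷ [])     = ⟦sub⟧ᴮ σ t
  ⟦sub⟧ᴬ σ (t ∷ u ∷ as) = cong₂ _,_ (⟦sub⟧ᴮ σ t) (⟦sub⟧ᴬ σ (u ∷ as))
  ⟦sub⟧ᴮ {n = n} σ t = trans (cong (QF.pack n) (⟦sub⟧ (exts σ) t))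
    (sym (QF.ς-pack n _ _ ((λ x → ⟦ren⟧ wk (σ $ˢ x)) , (λ k → refl)) ⟦ t ⟧))

  fold : ∀ X → T S X → ∣ Q.R X ∣
  fold X t = ⟦ t ⟧

  ⟦argsOf⟧  : ∀ s (a : TF.PObj s X) → ⟦ argsOf s a ⟧ᴬ ≡ powMap fold s X a
  ⟦argsOf⟧ᴮ : ∀ n (u : TF.DObj n X) → QF.pack n ⟦ unpackTm n u ⟧ ≡ derivMap fold n X u
  ⟦argsOf⟧ []          _       = refl
  ⟦argsOf⟧ (n ∷ [])    u       = ⟦argsOf⟧ᴮ n u
  ⟦argsOf⟧ (n ∷ m ∷ s) (u , a) = cong₂ _,_ (⟦argsOf⟧ᴮ n u) (⟦argsOf⟧ (m ∷ s) a)
  ⟦argsOf⟧ᴮ {X} n u = begin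
    QF.pack n ⟦ unpackTm n u ⟧                ≡⟨ cong (QF.pack n) (⟦ren⟧ _ r) ⟩
    QF.pack n (Q.Rmap (fromAdj n) · ⟦ r ⟧)    ≡⟨ QF.pack-fromAdj n _ ⟩
    QF.inD n (fold (Adj n X) r)               ≡⟨ sym (derivMap-inD fold n X r) ⟩
    derivMap fold n X (TF.inD n r)            ≡⟨ cong (derivMap fold n X) (TF.inD-outD n u) ⟩
    derivMap fold n X u                       ∎
    where
    open ≡-Reasoning
    r : T S (Adj n X)
    r = TF.outD n u

  foldMor : RepMor termRep Q
  foldMor = record
    { mor = record
      { τ   = λ X → record { fun = fold X ; mono = λ { refl → Pre.≤-refl (Q.R X) } }
      ; τ-σ = λ f t → ⟦sub⟧ (closed f) t
      ; τ-η = λ x → refl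
      }
    ; mor-op = λ i X a → cong (opQ i) (⟦argsOf⟧ (ar i) a)
    }

  module _ (m : RepMor termRep Q) where
    private
      module m = RelMonadMor (RepMor.mor m)
      τ : ∀ X → T S X → ∣ Q.R X ∣
      τ = RepMor.τ m

    τ-ren : (ρ : Ren X [] Y []) (t : T S X) → τ Y (ren ρ t) ≡ Q.Rmap (ρ $ʳ_) · τ X t
    τ-ren {X} {Y} ρ t = begin
      τ Y (ren ρ t)                                  ≡⟨ cong (τ Y) (sym (sub-var (λ _ → refl) t)) ⟩
      τ Y (sub (closed (λ x → var (ρ $ʳ x))) t)      ≡⟨ m.τ-σ _ t ⟩
      Q.σ (λ x → τ Y (var (ρ $ʳ x))) · τ X t         ≡⟨ Q.σ-cong (λ x → m.τ-η (ρ $ʳ x)) _ ⟩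
      Q.Rmap (ρ $ʳ_) · τ X t                         ∎
      where open ≡-Reasoning

    flatten : Tm S X Γ → T S (Ctx X Γ)
    flatten = ren ren⟨ (λ x → x) ⟩

    flattenᴬ : Args S X ns Γ → Args S (Ctx X Γ) ns []
    flattenᴬ = renA ren⟨ (λ x → x) ⟩

    unique  : (t : Tm S X Γ) → ⟦ t ⟧ ≡ τ (Ctx X Γ) (flatten t)
    uniqueᴬ : (as : Args S X ns Γ) → ⟦ as ⟧ᴬ ≡ powMap τ ns (Ctx X Γ) (argsTo ns (flattenᴬ as))
    uniqueᴮ : ∀ {X Γ n} (t : Tm S X (n ∷ Γ)) →
              QF.pack n ⟦ t ⟧ ≡ derivMap τ n (Ctx X Γ) (packTm n (ren (ext ren⟨ (λ x → x) ⟩) t))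
    unique (var x) = sym (m.τ-η x)
    unique {X} {Γ} (op i as) = begin
      opQ i ⟦ as ⟧ᴬ
        ≡⟨ cong (opQ i) (uniqueᴬ as) ⟩
      opQ i (powMap τ (ar i) (Ctx X Γ) (argsTo (ar i) (flattenᴬ as)))
        ≡⟨ sym (RepMor.mor-op m i _ _) ⟩
      τ (Ctx X Γ) (op i (argsOf (ar i) (argsTo (ar i) (flattenᴬ as))))
        ≡⟨ cong (λ bs → τ (Ctx X Γ) (op i bs)) (argsOf-argsTo (ar i) (flattenᴬ as)) ⟩
      τ (Ctx X Γ) (op i (flattenᴬ as)) ∎
      where open ≡-Reasoning
    uniqueᴬ []           = refl
    uniqueᴬ (t ∷ [])     = uniqueᴮ t
    uniqueᴬ (t ∷ u ∷ as) = cong₂ _,_ (uniqueᴮ t) (uniqueᴬ (u ∷ as))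
    uniqueᴮ {X} {Γ} {n} t = begin
      QF.inD n (Q.Rmap (toAdj n) · ⟦ t ⟧)
        ≡⟨ cong (λ q → QF.inD n (Q.Rmap (toAdj n) · q)) (unique t) ⟩
      QF.inD n (Q.Rmap (toAdj n) · τ _ (flatten t))
        ≡⟨ cong (QF.inD n) (sym (τ-ren ren⟨ toAdj n ⟩ (flatten t))) ⟩
      QF.inD n (τ _ (ren ren⟨ toAdj n ⟩ (flatten t)))
        ≡⟨ cong (λ r → QF.inD n (τ _ r)) flatten-under ⟩
      QF.inD n (τ _ (ren ren⟨ toAdj n ⟩ t′))
        ≡⟨ sym (derivMap-inD τ n (Ctx X Γ) _) ⟩
      derivMap τ n (Ctx X Γ) (packTm n t′) ∎
      where
      open ≡-Reasoning
      t′ : Tm S (Ctx X Γ) (n ∷ [])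
      t′ = ren (ext ren⟨ (λ x → x) ⟩) t
      flatten-under : ren ren⟨ toAdj n ⟩ (flatten t) ≡ ren ren⟨ toAdj n ⟩ t′
      flatten-under = trans (ren-ren {ρ = ren⟨ toAdj n ⟩} (λ _ → refl) t)
        (sym (ren-ren (λ { (inj₁ x) → refl ; (inj₂ k) → refl }) t))

    fold-unique : ∀ X (t : T S X) → fold X t ≡ τ X t
    fold-unique X t = trans (unique t) (cong (τ X) (ren-id (λ _ → refl) t))

mainTheorem3 : (S : Sig) →
    Σ (Rep S) λ R → IsInitial R × (∀ (X : Set) → RelMonad.R (Rep.mon R) X ≡ Δ (T S X))
mainTheorem3 S = termRep , isInitial , λ X → refl
  where
  open TermRepresentation S using (termRep)
  isInitial : IsInitial termRep
  isInitial Q = foldMor , fold-unique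
    where open Initiality S Q
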